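{- Let $q$ be a prime power, $r \geq 2$ an integer, and $S := \left\langle q^{r-1}, \frac{q^r-1}{q-1}\right\rangle$. Then $$S = \left\{\lambda_1 \frac{q^{r-1}-1}{q-1} + \lambda_2 : \lambda_1, \lambda_2 \in \mathbb{N},\ \frac{\lambda_1}{q} \leq \lambda_2 \leq \frac{\lambda_1}{q-1}\right\}.$$
   Context: $\mathbb{N} = \{0,1,2,\ldots\}$; $\langle a,b\rangle$ denotes the set of all $\mathbb{N}$-linear combinations of $a$ and $b$. -}

module Defs where

open import Data.Nat using (ℕ; zero; suc; _+_; _*_; _∸_; _^_; _≤_)
open import Data.Nat.DivMod using (_/_)
open import Data.Nat.Primality using (Prime)
open import Data.Product using (Σ; _×_; ∃-syntax)

IsPrimePower : ℕ → Set
IsPrimePower q = ∃[ p ] ∃[ k ] (Prime p × 1 ≤ k × q ≡′ p ^ k)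
  where open import Relation.Binary.PropositionalEquality using () renaming (_≡_ to _≡′_)

-- (q ^ m - 1) / (q - 1), natural-number division; only used for q ≥ 2
-- (where the division is exact); defined as 0 for q < 2 (never used there).
qNum : ℕ → ℕ → ℕ
qNum zero m = 0
qNum (suc zero) m = 0
qNum q@(suc (suc k)) m = ((q ^ m) ∸ 1) / (suc k)

_∈⟨_,_⟩ : ℕ → ℕ → ℕ → Set
n ∈⟨ a , b ⟩ = ∃[ x ] ∃[ y ] (n ≡′ x * a + y * b)
  where open import Relation.Binary.PropositionalEquality using () renaming (_≡_ to _≡′_)

-- Write q = d + 1 and A = (q^(r-1) - 1)/(q - 1). The generators are q^(r-1) = d A + 1 and
-- (q^r - 1)/(q - 1) = q A + 1, so x q^(r-1) + y (q^r - 1)/(q - 1) = (d (x + y) + y) A + (x + y).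
-- Putting λ₂ = x + y and λ₁ = d λ₂ + y, the conditions d λ₂ ≤ λ₁ ≤ q λ₂ say exactly that
-- 0 ≤ y ≤ λ₂, so (x, y) ↦ (λ₁, λ₂) is onto the pairs described on the right.
module Submission where

open import Defs
open import Data.Nat using (ℕ; zero; suc; _+_; _*_; _∸_; _^_; _≤_; s≤s; z≤n; nonTrivial⇒n>1)
open import Data.Nat.Properties
  using (≤-trans; +-comm; m≤m+n; +-monoʳ-≤; +-cancelˡ-≤; m+n∸n≡m; *-comm;
         ^-monoʳ-≤; ^-monoˡ-≤; m≤n⇒∃[o]m+o≡n)
open import Data.Nat.DivMod using (_/_; m*n/n≡m)
open import Data.Nat.Primality using (prime⇒nonTrivial)
open import Data.Nat.Tactic.RingSolver using (solve-∀)
open import Data.Product using (_×_; ∃-syntax; _,_)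
open import Relation.Binary.PropositionalEquality
  using (_≡_; refl; sym; trans; cong; subst; module ≡-Reasoning)
open import Function.Bundles using (_⇔_; mk⇔)

primePower⇒≥2 : ∀ {q} → IsPrimePower q → 2 ≤ q
primePower⇒≥2 (p , k , p-prime , k≥1 , refl) =
  ≤-trans (^-monoʳ-≤ 2 k≥1) (^-monoˡ-≤ k (nonTrivial⇒n>1 p {{prime⇒nonTrivial p-prime}}))

geometricSum : ℕ → ℕ → ℕ
geometricSum q zero    = 0
geometricSum q (suc m) = 1 + q * geometricSum q m

geometricSum-closed : ∀ d m → d * geometricSum (suc d) m + 1 ≡ suc d ^ m
geometricSum-closed d zero    = cong (_+ 1) (*-comm d 0)
geometricSum-closed d (suc m) = begin
  d * (1 + suc d * g) + 1  ≡⟨ factor d g ⟩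
  suc d * (d * g + 1)      ≡⟨ cong (suc d *_) (geometricSum-closed d m) ⟩
  suc d * suc d ^ m        ∎
  where
  open ≡-Reasoning
  g = geometricSum (suc d) m
  factor : ∀ d g → d * (1 + suc d * g) + 1 ≡ suc d * (d * g + 1)
  factor = solve-∀

qNum≡geometricSum : ∀ c m → qNum (2 + c) m ≡ geometricSum (2 + c) m
qNum≡geometricSum c m = begin
  ((2 + c) ^ m ∸ 1) / suc c      ≡⟨ cong (λ t → (t ∸ 1) / suc c) (sym (geometricSum-closed (suc c) m)) ⟩
  (suc c * g + 1 ∸ 1) / suc c    ≡⟨ cong (_/ suc c) (m+n∸n≡m (suc c * g) 1) ⟩
  (suc c * g) / suc c            ≡⟨ cong (_/ suc c) (*-comm (suc c) g) ⟩
  (g * suc c) / suc c            ≡⟨ m*n/n≡m g (suc c) ⟩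
  g                              ∎
  where
  open ≡-Reasoning
  g = geometricSum (2 + c) m

∈⟨d*A+1,sucd*A+1⟩⇔cone : ∀ d A n →
  n ∈⟨ d * A + 1 , suc d * A + 1 ⟩ ⇔
  (∃[ λ₁ ] ∃[ λ₂ ] (n ≡ λ₁ * A + λ₂ × λ₁ ≤ suc d * λ₂ × d * λ₂ ≤ λ₁))
∈⟨d*A+1,sucd*A+1⟩⇔cone d A n = mk⇔ toCoordinates fromCoordinates
  where
  regroup : ∀ d A x y →
    x * (d * A + 1) + y * (suc d * A + 1) ≡ (d * (y + x) + y) * A + (y + x)
  regroup = solve-∀

  sucd-split : ∀ d l → suc d * l ≡ l + d * l
  sucd-split = solve-∀

  toCoordinates : n ∈⟨ d * A + 1 , suc d * A + 1 ⟩ →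
    ∃[ λ₁ ] ∃[ λ₂ ] (n ≡ λ₁ * A + λ₂ × λ₁ ≤ suc d * λ₂ × d * λ₂ ≤ λ₁)
  toCoordinates (x , y , n≡) =
    d * (y + x) + y , y + x , trans n≡ (regroup d A x y) , upper , m≤m+n (d * (y + x)) y
    where
    upper : d * (y + x) + y ≤ suc d * (y + x)
    upper = subst (d * (y + x) + y ≤_)
      (trans (+-comm (d * (y + x)) (y + x)) (sym (sucd-split d (y + x))))
      (+-monoʳ-≤ (d * (y + x)) (m≤m+n y x))

  fromCoordinates : ∃[ λ₁ ] ∃[ λ₂ ] (n ≡ λ₁ * A + λ₂ × λ₁ ≤ suc d * λ₂ × d * λ₂ ≤ λ₁) →
    n ∈⟨ d * A + 1 , suc d * A + 1 ⟩
  fromCoordinates (_ , λ₂ , n≡ , upper , lower) with m≤n⇒∃[o]m+o≡n lower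
  ... | y , refl with m≤n⇒∃[o]m+o≡n (y≤λ₂ upper)
    where
    y≤λ₂ : d * λ₂ + y ≤ suc d * λ₂ → y ≤ λ₂
    y≤λ₂ le = +-cancelˡ-≤ (d * λ₂) y λ₂
      (subst (d * λ₂ + y ≤_) (trans (sucd-split d λ₂) (+-comm λ₂ (d * λ₂))) le)
  ... | x , refl = x , y , trans n≡ (sym (regroup d A x y))

lemma5p1 : (q r : ℕ) → IsPrimePower q → 2 ≤ r → (n : ℕ) →
    (n ∈⟨ q ^ (r ∸ 1) , qNum q r ⟩) ⇔
    (∃[ λ₁ ] ∃[ λ₂ ] (n ≡ λ₁ * qNum q (r ∸ 1) + λ₂ × λ₁ ≤ q * λ₂ × (q ∸ 1) * λ₂ ≤ λ₁))
lemma5p1 q r q-pp _ n with primePower⇒≥2 q-pp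
lemma5p1 (suc (suc c)) (suc m) _ _ n | s≤s (s≤s z≤n)
  rewrite qNum≡geometricSum c m
        | qNum≡geometricSum c (suc m)
        | +-comm 1 ((2 + c) * geometricSum (2 + c) m)
        | sym (geometricSum-closed (suc c) m)
  = ∈⟨d*A+1,sucd*A+1⟩⇔cone (suc c) (geometricSum (2 + c) m) n
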